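{- If $G$ is a graph with $\Delta(G)\le 2$, then ${\rm vs_{\chi}}(G)={\rm ivs_{\chi}}(G)$.
   Context: All graphs are finite and simple. $\chi(G)$ is the chromatic number and $\Delta(G)$ the maximum degree of $G$. ${\rm vs_{\chi}}(G)$ is the minimum size of a set $S\subseteq V(G)$ such that $\chi(G-S)=\chi(G)-1$; ${\rm ivs_{\chi}}(G)$ is the minimum size of an independent set $S\subseteq V(G)$ such that $\chi(G-S)=\chi(G)-1$. -}

module Defs where

open import Data.Nat using (ℕ; _≤_; _∸_)
open import Data.Fin using (Fin)
open import Data.Fin.Subset using (Subset; _∈_; _∉_; ∣_∣)
open import Data.Bool using (Bool; true; false)
open import Data.Vec using (tabulate)
open import Data.Product using (Σ; _×_; ∃)
open import Relation.Binary.PropositionalEquality using (_≡_)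
open import Data.Empty renaming (⊥ to Empty)

record Graph (n : ℕ) : Set where
  field
    adj   : Fin n → Fin n → Bool
    sym   : ∀ u v → adj u v ≡ adj v u
    irrefl : ∀ v → adj v v ≡ false
open Graph public

N : ∀ {n} → Graph n → Fin n → Subset n
N G v = tabulate (adj G v)

degree : ∀ {n} → Graph n → Fin n → ℕ
degree G v = ∣ N G v ∣

MaxDegreeAtMost : ∀ {n} → Graph n → ℕ → Set
MaxDegreeAtMost G d = ∀ v → degree G v ≤ d

-- A proper k-colouring of G - S (the subgraph induced by V(G) \ S):
-- colours are assigned only to vertices outside S.
ProperColouringMinus : ∀ {n} → Graph n → Subset n → ℕ → Set
ProperColouringMinus {n} G S k =
  Σ ((v : Fin n) → v ∉ S → Fin k) λ c →
    ∀ u v (pu : u ∉ S) (pv : v ∉ S) → adj G u v ≡ true → c u pu ≡ c v pv → Empty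

ColourableMinus : ∀ {n} → Graph n → Subset n → ℕ → Set
ColourableMinus G S k = ProperColouringMinus G S k

IsChromNumMinus : ∀ {n} → Graph n → Subset n → ℕ → Set
IsChromNumMinus G S k = ColourableMinus G S k × (∀ j → ColourableMinus G S j → k ≤ j)

open import Data.Fin.Subset using (⊥)
IsChromNum : ∀ {n} → Graph n → ℕ → Set
IsChromNum G k = IsChromNumMinus G ⊥ k

Independent : ∀ {n} → Graph n → Subset n → Set
Independent G S = ∀ u v → u ∈ S → v ∈ S → adj G u v ≡ false

ChiReducing : ∀ {n} → Graph n → Subset n → Set
ChiReducing G S = ∃ λ k → IsChromNum G k × IsChromNumMinus G S (k ∸ 1)

IsVsChi : ∀ {n} → Graph n → ℕ → Set
IsVsChi G m =
  (∃ λ S → ChiReducing G S × ∣ S ∣ ≡ m) ×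
  (∀ S → ChiReducing G S → m ≤ ∣ S ∣)

IsIvsChi : ∀ {n} → Graph n → ℕ → Set
IsIvsChi G m =
  (∃ λ S → Independent G S × ChiReducing G S × ∣ S ∣ ≡ m) ×
  (∀ S → Independent G S → ChiReducing G S → m ≤ ∣ S ∣)

-- A χ-reducing set S can be traded for an independent one of at most the same
-- size, so the two minima coincide. If χ(G) ≤ 1 every χ-reducing set is already
-- independent. If χ(G) ≥ 3, an endpoint u of an edge inside S has at most one
-- neighbour outside S (its other neighbour lies in S), and there are at least
-- two colours for G - S, so u can be given back a colour: S - u is still
-- χ-reducing. If χ(G) = 2, then G - S is edgeless; fix a bipartition (B, V∖B)
-- and let u ∈ B be an endpoint of an edge inside S. Replacing u by its (at most
-- one) neighbour outside S keeps G - S edgeless and nonempty, does not increase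
-- |S|, and strictly decreases |S ∩ B|.
module Submission where

open import Defs hiding (sym)
open import Data.Bool using (Bool; true; false)
import Data.Bool as Bool
open import Data.Bool.Properties using (¬-not; not-¬)
open import Data.Empty using (⊥-elim)
open import Data.Fin using (Fin; zero; suc; fromℕ; inject₁; punchOut; _≟_)
open import Data.Fin.Properties using (any?; all?; ¬Fin0; fromℕ≢inject₁; inject₁-injective; punchOut-injective)
open import Data.Fin.Subset
  using (Subset; inside; outside; _∈_; _∉_; _⊆_; _⊂_; _∪_; _∩_; _─_; _-_; ⁅_⁆; ∣_∣; ⊥)
open import Data.Fin.Subset.Properties
  using (_∈?_; anySubset?; ∉⊥; ∣p∣≤∣x∷p∣; ∣⁅x⁆∣≡1; x∈⁅x⁆; x∈⁅y⁆⇒x≡y; p⊆q⇒∣p∣≤∣q∣; p⊂q⇒∣p∣<∣q∣;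
         x∈p∩q⁺; x∈p∩q⁻; x∈p∪q⁺; x∈p∪q⁻; ∪-identityˡ; x∈p∧x∉q⇒x∈p─q; p─q⊆p; x∈p∧x≢y⇒x∈p-y;
         x∈p⇒∣p-x∣<∣p∣)
open import Data.Nat using (ℕ; zero; suc; _+_; _≤_; _<_; _∸_; z≤n; s≤s; s≤s⁻¹)
open import Data.Nat.Induction using (<-rec)
import Data.Nat.Properties as ℕ
open import Data.Product using (∃; ∃₂; _×_; _,_; proj₁; proj₂)
open import Data.Sum using (_⊎_; inj₁; inj₂; [_,_]′)
open import Data.Vec using (_∷_; []; tabulate; here; there)
open import Data.Vec.Functional using (updateAt)
open import Data.Vec.Functional.Properties using (updateAt-updates; updateAt-minimal)
open import Data.Vec.Properties using ([]=⇒lookup; lookup⇒[]=; lookup∘tabulate)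
open import Function using (_∘_; const)
open import Relation.Binary.PropositionalEquality using (_≡_; _≢_; refl; sym; trans; cong; subst)
open import Relation.Nullary using (Dec; yes; no; does; contradiction)
open import Relation.Nullary.Decidable using (dec-true; map′; _×-dec_)
open import Relation.Unary using (Pred; Decidable)

module _ {n : ℕ} where

  ∈-tabulate⁺ : ∀ {f : Fin n → Bool} {x} → f x ≡ inside → x ∈ tabulate f
  ∈-tabulate⁺ {f} {x} fx≡inside = lookup⇒[]= x _ (trans (lookup∘tabulate f x) fx≡inside)

  ∈-tabulate⁻ : ∀ {f : Fin n → Bool} {x} → x ∈ tabulate f → f x ≡ inside
  ∈-tabulate⁻ {f} {x} x∈ = trans (sym (lookup∘tabulate f x)) ([]=⇒lookup x∈)

  fibre : ∀ {k} → (Fin n → Fin k) → Fin k → Subset n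
  fibre f a = tabulate λ x → does (f x ≟ a)

  ∈-fibre⁺ : ∀ {k} {f : Fin n → Fin k} {a x} → f x ≡ a → x ∈ fibre f a
  ∈-fibre⁺ {f = f} {a} {x} fx≡a = ∈-tabulate⁺ (dec-true (f x ≟ a) fx≡a)

  ∈-fibre⁻ : ∀ {k} {f : Fin n → Fin k} {a x} → x ∈ fibre f a → f x ≡ a
  ∈-fibre⁻ {f = f} {a} {x} x∈ with f x ≟ a | ∈-tabulate⁻ {x = x} x∈
  ... | yes fx≡a | _ = fx≡a
  ... | no _     | ()

  x∈p⇒0<∣p∣ : ∀ {x : Fin n} {p} → x ∈ p → 0 < ∣ p ∣
  x∈p⇒0<∣p∣ {x} {p} x∈p = subst (_≤ ∣ p ∣) (∣⁅x⁆∣≡1 x)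
    (p⊆q⇒∣p∣≤∣q∣ λ y∈⁅x⁆ → subst (_∈ p) (sym (x∈⁅y⁆⇒x≡y x y∈⁅x⁆)) x∈p)

  ∣p∣≤1∧x∈p∧y∈p⇒x≡y : ∀ {p : Subset n} {x y} → ∣ p ∣ ≤ 1 → x ∈ p → y ∈ p → x ≡ y
  ∣p∣≤1∧x∈p∧y∈p⇒x≡y {p} {x} {y} ∣p∣≤1 x∈p y∈p with x ≟ y
  ... | yes x≡y = x≡y
  ... | no x≢y = contradiction 2≤∣p∣ (ℕ.<⇒≱ (s≤s ∣p∣≤1))
    where
    2≤∣p∣ : 2 ≤ ∣ p ∣
    2≤∣p∣ = ℕ.≤-trans (s≤s (x∈p⇒0<∣p∣ (x∈p∧x≢y⇒x∈p-y y∈p (x≢y ∘ sym)))) (x∈p⇒∣p-x∣<∣p∣ x∈p)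

x∈p─q⇒x∉q : ∀ {n} {x : Fin n} {p q : Subset n} → x ∈ p ─ q → x ∉ q
x∈p─q⇒x∉q {p = _ ∷ _} {inside ∷ _} () here
x∈p─q⇒x∉q {p = _ ∷ _} {_ ∷ _} (there x∈p─q) (there x∈q) = x∈p─q⇒x∉q x∈p─q x∈q

∣p∪q∣≤∣p∣+∣q∣ : ∀ {n} (p q : Subset n) → ∣ p ∪ q ∣ ≤ ∣ p ∣ + ∣ q ∣
∣p∪q∣≤∣p∣+∣q∣ []            []            = z≤n
∣p∪q∣≤∣p∣+∣q∣ (outside ∷ p) (outside ∷ q) = ∣p∪q∣≤∣p∣+∣q∣ p q
∣p∪q∣≤∣p∣+∣q∣ (outside ∷ p) (inside ∷ q)  =
  subst (suc ∣ p ∪ q ∣ ≤_) (sym (ℕ.+-suc ∣ p ∣ ∣ q ∣)) (s≤s (∣p∪q∣≤∣p∣+∣q∣ p q))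
∣p∪q∣≤∣p∣+∣q∣ (inside ∷ p)  (s ∷ q)       =
  s≤s (ℕ.≤-trans (∣p∪q∣≤∣p∣+∣q∣ p q) (ℕ.+-monoʳ-≤ ∣ p ∣ (∣p∣≤∣x∷p∣ s q)))

module _ {p} {P : Pred ℕ p} (P? : Decidable P) where

  minimal : ∀ b → P b → ∃ λ m → P m × (∀ j → P j → m ≤ j)
  minimal = <-rec _ search
    where
    search : ∀ b → (∀ {j} → j < b → P j → ∃ λ m → P m × (∀ j → P j → m ≤ j)) →
             P b → ∃ λ m → P m × (∀ j → P j → m ≤ j)
    search b below Pb with ℕ.anyUpTo? P? b
    ... | yes (j , j<b , Pj) = below j<b Pj
    ... | no none = b , Pb , λ j Pj → ℕ.≮⇒≥ λ j<b → none (j , j<b , Pj)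

module _ {n : ℕ} (G : Graph n) where

  adj-sym : ∀ {x y} → adj G x y ≡ true → adj G y x ≡ true
  adj-sym {x} {y} = trans (Graph.sym G y x)

  adj-irrefl : ∀ {x} → adj G x x ≢ true
  adj-irrefl {x} x~x with trans (sym x~x) (irrefl G x)
  ... | ()

  ∈N⁺ : ∀ {u x} → adj G u x ≡ true → x ∈ N G u
  ∈N⁺ = ∈-tabulate⁺

  ∈N⁻ : ∀ {u x} → x ∈ N G u → adj G u x ≡ true
  ∈N⁻ = ∈-tabulate⁻

  EdgeIn : Subset n → Set
  EdgeIn S = ∃₂ λ u v → u ∈ S × v ∈ S × adj G u v ≡ true

  independent-or-edge : ∀ S → Independent G S ⊎ EdgeIn S
  independent-or-edge S
    with any? (λ u → any? λ v → u ∈? S ×-dec v ∈? S ×-dec adj G u v Bool.≟ true)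
  ... | yes (u , v , edge) = inj₂ (u , v , edge)
  ... | no noEdge = inj₁ λ u v u∈S v∈S → ¬-not λ u~v → noEdge (u , v , u∈S , v∈S , u~v)

  independent? : ∀ S → Dec (Independent G S)
  independent? S with independent-or-edge S
  ... | inj₁ S-ind = yes S-ind
  ... | inj₂ (u , v , u∈S , v∈S , u~v) = no λ S-ind → not-¬ u~v (S-ind u v u∈S v∈S)

  EdgelessMinus : Subset n → Set
  EdgelessMinus S = ∀ x y → x ∉ S → y ∉ S → adj G x y ≡ false

  ProperMinus : ∀ {k} → Subset n → (Fin n → Fin k) → Set
  ProperMinus S f = ∀ x y → x ∉ S → y ∉ S → adj G x y ≡ true → f x ≢ f y

  proper⇒colourable : ∀ {S k} {f : Fin n → Fin k} → ProperMinus S f → ColourableMinus G S k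
  proper⇒colourable {f = f} f-proper = (λ x _ → f x) , f-proper

  colourable⇒proper : ∀ {S k} → ColourableMinus G S (suc k) → ∃ (ProperMinus S)
  colourable⇒proper {S} {k} (c , c-proper) = (λ x → colour x (x ∈? S)) , λ x y → proper x y (x ∈? S) (y ∈? S)
    where
    colour : ∀ x → Dec (x ∈ S) → Fin (suc k)
    colour x (yes _)   = zero
    colour x (no x∉S) = c x x∉S

    proper : ∀ x y dx dy → x ∉ S → y ∉ S → adj G x y ≡ true → colour x dx ≢ colour y dy
    proper x y (yes x∈S) _          x∉S _   = contradiction x∈S x∉S
    proper x y (no _)    (yes y∈S)  _   y∉S = contradiction y∈S y∉S
    proper x y (no x∉S)  (no y∉S)   _   _   = c-proper x y x∉S y∉S

  colourable-⊆ : ∀ {S T k} → S ⊆ T → ColourableMinus G S k → ColourableMinus G T k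
  colourable-⊆ S⊆T (c , c-proper) =
    (λ x x∉T → c x (x∉T ∘ S⊆T)) , λ x y x∉T y∉T → c-proper x y (x∉T ∘ S⊆T) (y∉T ∘ S⊆T)

  colourable₀⇒covers : ∀ {S} → ColourableMinus G S 0 → ∀ x → x ∈ S
  colourable₀⇒covers {S} (c , _) x with x ∈? S
  ... | yes x∈S = x∈S
  ... | no x∉S = ⊥-elim (¬Fin0 (c x x∉S))

  covers⇒colourable₀ : ∀ {S} → (∀ x → x ∈ S) → ColourableMinus G S 0
  covers⇒colourable₀ covers = (λ x x∉S → contradiction (covers x) x∉S) , λ x _ x∉S → contradiction (covers x) x∉S

  peel : ∀ {S k} → ColourableMinus G S (suc k) → ∃ λ I → Independent G I × ColourableMinus G (S ∪ I) k
  peel {S} {k} c = I , I-independent , (d , d-proper)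
    where
    f : Fin n → Fin (suc k)
    f = proj₁ (colourable⇒proper c)

    f-proper : ProperMinus S f
    f-proper = proj₂ (colourable⇒proper c)

    I : Subset n
    I = fibre f (fromℕ k) ─ S

    I-independent : Independent G I
    I-independent u v u∈I v∈I = ¬-not λ u~v →
      f-proper u v (x∈p─q⇒x∉q u∈I) (x∈p─q⇒x∉q v∈I) u~v
        (trans (∈-fibre⁻ {f = f} (p─q⊆p _ S u∈I)) (sym (∈-fibre⁻ {f = f} (p─q⊆p _ S v∈I))))

    notLast : ∀ {x} → x ∉ S ∪ I → fromℕ k ≢ f x
    notLast x∉ last≡fx =
      x∉ (x∈p∪q⁺ (inj₂ (x∈p∧x∉q⇒x∈p─q (∈-fibre⁺ {f = f} (sym last≡fx)) (x∉ ∘ x∈p∪q⁺ ∘ inj₁))))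

    d : (x : Fin n) → x ∉ S ∪ I → Fin k
    d x x∉ = punchOut (notLast x∉)

    d-proper : ∀ x y (x∉ : x ∉ S ∪ I) (y∉ : y ∉ S ∪ I) → adj G x y ≡ true → d x x∉ ≢ d y y∉
    d-proper x y x∉ y∉ x~y dx≡dy =
      f-proper x y (x∉ ∘ x∈p∪q⁺ ∘ inj₁) (y∉ ∘ x∈p∪q⁺ ∘ inj₁) x~y (punchOut-injective (notLast x∉) (notLast y∉) dx≡dy)

  extend : ∀ {S I k} → Independent G I → ColourableMinus G (S ∪ I) k → ColourableMinus G S (suc k)
  extend {S} {I} {k} I-independent (c , c-proper) =
    (λ x x∉S → colour x x∉S (x ∈? I)) , λ x y x∉S y∉S → proper x y x∉S y∉S (x ∈? I) (y ∈? I)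
    where
    outside-S∪I : ∀ {x} → x ∉ S → x ∉ I → x ∉ S ∪ I
    outside-S∪I x∉S x∉I = [ x∉S , x∉I ]′ ∘ x∈p∪q⁻ S I

    colour : ∀ x → x ∉ S → Dec (x ∈ I) → Fin (suc k)
    colour x _   (yes _)   = fromℕ k
    colour x x∉S (no x∉I) = inject₁ (c x (outside-S∪I x∉S x∉I))

    proper : ∀ x y x∉S y∉S dx dy → adj G x y ≡ true → colour x x∉S dx ≢ colour y y∉S dy
    proper x y _   _   (yes x∈I) (yes y∈I) x~y _ = not-¬ x~y (I-independent x y x∈I y∈I)
    proper x y _   _   (yes _)   (no _)    _   = fromℕ≢inject₁
    proper x y _   _   (no _)    (yes _)   _   = fromℕ≢inject₁ ∘ sym
    proper x y x∉S y∉S (no x∉I) (no y∉I) x~y =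
      c-proper x y (outside-S∪I x∉S x∉I) (outside-S∪I y∉S y∉I) x~y ∘ inject₁-injective

  colourable? : ∀ k S → Dec (ColourableMinus G S k)
  colourable? zero    S = map′ covers⇒colourable₀ colourable₀⇒covers (all? (_∈? S))
  colourable? (suc k) S =
    map′ (λ (I , I-independent , c) → extend I-independent c) peel
         (anySubset? λ I → independent? I ×-dec colourable? k (S ∪ I))

  colourable-n : ∀ S → ColourableMinus G S n
  colourable-n S = (λ x _ → x) , λ { x .x _ _ x~x refl → adj-irrefl x~x }

  chromatic : ∀ S → ∃ (IsChromNumMinus G S)
  chromatic S = minimal (λ k → colourable? k S) n (colourable-n S)

  chromatic-unique : ∀ {S a b} → IsChromNumMinus G S a → IsChromNumMinus G S b → a ≡ b
  chromatic-unique {a = a} {b} (a-col , a-min) (b-col , b-min) = ℕ.≤-antisym (a-min b b-col) (b-min a a-col)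

  chiReducing? : ∀ S → Dec (ChiReducing G S)
  chiReducing? S with chromatic ⊥ | chromatic S
  ... | k , χG | t , χS =
    map′ (λ { refl → k , χG , χS })
         (λ (k′ , χG′ , χS′) → trans (chromatic-unique χS χS′) (cong (_∸ 1) (chromatic-unique χG′ χG)))
         (t ℕ.≟ k ∸ 1)

  chiReducing-exists : ∃ (ChiReducing G)
  chiReducing-exists with chromatic ⊥
  ... | zero , χG = ⊥ , zero , χG , χG
  ... | suc k , χG with peel (proj₁ χG)
  ...   | I , I-independent , c =
    ⊥ ∪ I , suc k , χG , c , λ j c′ → s≤s⁻¹ (proj₂ χG (suc j) (extend I-independent c′))

  vsChi-exists : ∃ (IsVsChi G)
  vsChi-exists =
    let (S₀ , S₀-reducing) = chiReducing-exists
        (m , witness , m-min) = minimal reducingOfSize? ∣ S₀ ∣ (S₀ , S₀-reducing , refl)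
    in m , witness , λ S S-reducing → m-min ∣ S ∣ (S , S-reducing , refl)
    where
    reducingOfSize? : ∀ j → Dec (∃ λ S → ChiReducing G S × ∣ S ∣ ≡ j)
    reducingOfSize? j = anySubset? λ S → chiReducing? S ×-dec ∣ S ∣ ℕ.≟ j

  colourable₁⇒edgeless : ∀ {S} → ColourableMinus G S 1 → EdgelessMinus S
  colourable₁⇒edgeless (c , c-proper) x y x∉S y∉S = ¬-not λ x~y → c-proper x y x∉S y∉S x~y (Fin1-≡ _ _)
    where
    Fin1-≡ : (i j : Fin 1) → i ≡ j
    Fin1-≡ zero zero = refl

  edgeless⇒chromatic₁ : ∀ {S x} → EdgelessMinus S → x ∉ S → IsChromNumMinus G S 1
  edgeless⇒chromatic₁ {S} {x} edgeless x∉S =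
    ((λ _ _ → zero) , λ u v u∉S v∉S u~v _ → not-¬ u~v (edgeless u v u∉S v∉S)) , atLeastOne
    where
    atLeastOne : ∀ j → ColourableMinus G S j → 1 ≤ j
    atLeastOne zero    (c , _) = ⊥-elim (¬Fin0 (c x x∉S))
    atLeastOne (suc j) _       = s≤s z≤n

  shift : Subset n → Fin n → Subset n
  shift S u = (S - u) ∪ (N G u ─ S)

  u∉shift : ∀ {S u} → u ∉ shift S u
  u∉shift {S} {u} u∈ with x∈p∪q⁻ (S - u) (N G u ─ S) u∈
  ... | inj₁ u∈S-u = x∈p─q⇒x∉q u∈S-u (x∈⁅x⁆ u)
  ... | inj₂ u∈N─S = adj-irrefl (∈N⁻ (p─q⊆p _ S u∈N─S))

  ∉shift⇒∉ : ∀ {S u z} → z ∉ shift S u → z ≢ u → z ∉ S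
  ∉shift⇒∉ z∉ z≢u z∈S = z∉ (x∈p∪q⁺ (inj₁ (x∈p∧x≢y⇒x∈p-y z∈S z≢u)))

  ∉shift⇒non-adjacent : ∀ {S u z} → z ∉ shift S u → z ≢ u → adj G u z ≡ false
  ∉shift⇒non-adjacent z∉ z≢u =
    ¬-not λ u~z → z∉ (x∈p∪q⁺ (inj₂ (x∈p∧x∉q⇒x∈p─q (∈N⁺ u~z) (∉shift⇒∉ z∉ z≢u))))

  shift-edgeless : ∀ {S u} → EdgelessMinus S → EdgelessMinus (shift S u)
  shift-edgeless {S} {u} edgeless x y x∉ y∉ with x ≟ u | y ≟ u
  ... | yes refl | yes refl = irrefl G x
  ... | yes refl | no y≢u   = ∉shift⇒non-adjacent y∉ y≢u
  ... | no x≢u   | yes refl = trans (Graph.sym G x y) (∉shift⇒non-adjacent x∉ x≢u)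
  ... | no x≢u   | no y≢u   = edgeless x y (∉shift⇒∉ x∉ x≢u) (∉shift⇒∉ y∉ y≢u)

  shift∩B⊂ : ∀ {S B u} → Independent G B → u ∈ S → u ∈ B → shift S u ∩ B ⊂ S ∩ B
  shift∩B⊂ {S} {B} {u} B-independent u∈S u∈B =
    shrinks , u , x∈p∩q⁺ (u∈S , u∈B) , u∉shift ∘ proj₁ ∘ x∈p∩q⁻ _ B
    where
    shrinks : shift S u ∩ B ⊆ S ∩ B
    shrinks x∈ with x∈p∩q⁻ (shift S u) B x∈
    ... | x∈shift , x∈B with x∈p∪q⁻ (S - u) (N G u ─ S) x∈shift
    ...   | inj₁ x∈S-u = x∈p∩q⁺ (p─q⊆p S ⁅ u ⁆ x∈S-u , x∈B)
    ...   | inj₂ x∈N─S =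
      contradiction (B-independent _ _ u∈B x∈B) (not-¬ (∈N⁻ (p─q⊆p _ S x∈N─S)))

  shrinkToIndependent : {X : Subset n → Set} (μ : Subset n → ℕ) →
    (∀ T → X T → EdgeIn T → ∃ λ T′ → X T′ × ∣ T′ ∣ ≤ ∣ T ∣ × μ T′ < μ T) →
    ∀ S → X S → ∃ λ S′ → Independent G S′ × X S′ × ∣ S′ ∣ ≤ ∣ S ∣
  shrinkToIndependent {X} μ improve S = <-rec Goal descend (μ S) S refl
    where
    Goal : ℕ → Set
    Goal m = ∀ T → μ T ≡ m → X T → ∃ λ S′ → Independent G S′ × X S′ × ∣ S′ ∣ ≤ ∣ T ∣

    descend : ∀ m → (∀ {k} → k < m → Goal k) → Goal m
    descend _ smaller T refl XT with independent-or-edge T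
    ... | inj₁ T-independent = T , T-independent , XT , ℕ.≤-refl
    ... | inj₂ edge with improve T XT edge
    ...   | T′ , XT′ , ∣T′∣≤∣T∣ , μT′<μT with smaller μT′<μT T′ refl XT′
    ...     | S′ , S′-independent , XS′ , ∣S′∣≤∣T′∣ =
      S′ , S′-independent , XS′ , ℕ.≤-trans ∣S′∣≤∣T′∣ ∣T′∣≤∣T∣

  module _ (Δ≤2 : MaxDegreeAtMost G 2) where

    ∣N─S∣≤1 : ∀ {S u v} → v ∈ S → adj G u v ≡ true → ∣ N G u ─ S ∣ ≤ 1
    ∣N─S∣≤1 {S} {u} {v} v∈S u~v = s≤s⁻¹ (ℕ.≤-trans (s≤s ∣N─S∣≤∣N-v∣) (ℕ.≤-trans (x∈p⇒∣p-x∣<∣p∣ (∈N⁺ u~v)) (Δ≤2 u)))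
      where
      ∣N─S∣≤∣N-v∣ : ∣ N G u ─ S ∣ ≤ ∣ N G u - v ∣
      ∣N─S∣≤∣N-v∣ = p⊆q⇒∣p∣≤∣q∣ {p = N G u ─ S} {q = N G u - v} λ x∈ →
        x∈p∧x≢y⇒x∈p-y (p─q⊆p _ S x∈) λ { refl → x∈p─q⇒x∉q x∈ v∈S }

    recolour : ∀ {S u v m} → v ∈ S → adj G u v ≡ true →
               ColourableMinus G S (suc (suc m)) → ColourableMinus G (S - u) (suc (suc m))
    recolour {S} {u} {v} {m} v∈S u~v c with colourable⇒proper c
    ... | f , f-proper = proper⇒colourable (updated (freeColour (any? (_∈? (N G u ─ S)))))
      where
      other : Fin (suc (suc m)) → Fin (suc (suc m))
      other zero    = suc zero
      other (suc _) = zero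

      Avoids : Fin (suc (suc m)) → Set
      Avoids a = ∀ x → x ∈ N G u ─ S → f x ≢ a

      freeColour : Dec (∃ λ w → w ∈ N G u ─ S) → ∃ Avoids
      freeColour (no none)       = zero , λ x x∈ _ → none (x , x∈)
      freeColour (yes (w , w∈)) = other (f w) , λ x x∈ fx≡ →
        otherDiffers (f w) (trans (sym fx≡) (cong f (∣p∣≤1∧x∈p∧y∈p⇒x≡y (∣N─S∣≤1 v∈S u~v) x∈ w∈)))
        where
        otherDiffers : ∀ a → other a ≢ a
        otherDiffers zero    ()
        otherDiffers (suc _) ()

      outside-S : ∀ {x} → x ∉ S - u → x ≢ u → x ∉ S
      outside-S x∉ x≢u x∈S = x∉ (x∈p∧x≢y⇒x∈p-y x∈S x≢u)

      neighbourOutside : ∀ {x} → x ∉ S - u → x ≢ u → adj G u x ≡ true → x ∈ N G u ─ S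
      neighbourOutside x∉ x≢u u~x = x∈p∧x∉q⇒x∈p─q (∈N⁺ u~x) (outside-S x∉ x≢u)

      updated : (free : ∃ Avoids) → ProperMinus (S - u) (updateAt f u (const (proj₁ free)))
      updated (a , avoids) x y x∉ y∉ x~y with x ≟ u | y ≟ u
      ... | yes refl | yes refl = contradiction x~y adj-irrefl
      ... | yes refl | no y≢u rewrite updateAt-updates x {const a} f | updateAt-minimal y x {const a} f y≢u =
        avoids y (neighbourOutside y∉ y≢u x~y) ∘ sym
      ... | no x≢u | yes refl rewrite updateAt-updates y {const a} f | updateAt-minimal x y {const a} f x≢u =
        avoids x (neighbourOutside x∉ x≢u (adj-sym x~y))
      ... | no x≢u | no y≢u rewrite updateAt-minimal x u {const a} f x≢u | updateAt-minimal y u {const a} f y≢u =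
        f-proper x y (outside-S x∉ x≢u) (outside-S y∉ y≢u) x~y

    removeStep : ∀ {m} T → IsChromNumMinus G T (suc (suc m)) → EdgeIn T →
                 ∃ λ T′ → IsChromNumMinus G T′ (suc (suc m)) × ∣ T′ ∣ ≤ ∣ T ∣ × ∣ T′ ∣ < ∣ T ∣
    removeStep T (T-col , T-min) (u , v , u∈T , v∈T , u~v) =
      T - u , (recolour v∈T u~v T-col , λ j c → T-min j (colourable-⊆ (p─q⊆p T ⁅ u ⁆) c)) ,
      ℕ.<⇒≤ ∣T-u∣<∣T∣ , ∣T-u∣<∣T∣
      where
      ∣T-u∣<∣T∣ : ∣ T - u ∣ < ∣ T ∣
      ∣T-u∣<∣T∣ = x∈p⇒∣p-x∣<∣p∣ u∈T

    ∣shift∣≤∣S∣ : ∀ {S u v} → u ∈ S → v ∈ S → adj G u v ≡ true → ∣ shift S u ∣ ≤ ∣ S ∣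
    ∣shift∣≤∣S∣ {S} {u} u∈S v∈S u~v = begin
      ∣ (S - u) ∪ (N G u ─ S) ∣    ≤⟨ ∣p∪q∣≤∣p∣+∣q∣ (S - u) (N G u ─ S) ⟩
      ∣ S - u ∣ + ∣ N G u ─ S ∣   ≤⟨ ℕ.+-monoʳ-≤ ∣ S - u ∣ (∣N─S∣≤1 v∈S u~v) ⟩
      ∣ S - u ∣ + 1               ≡⟨ ℕ.+-comm ∣ S - u ∣ 1 ⟩
      suc ∣ S - u ∣               ≤⟨ x∈p⇒∣p-x∣<∣p∣ u∈S ⟩
      ∣ S ∣                       ∎
      where open ℕ.≤-Reasoning

    shift-improves : ∀ {B T u v} → Independent G B → IsChromNumMinus G T 1 →
                     u ∈ T → v ∈ T → adj G u v ≡ true → u ∈ B →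
                     IsChromNumMinus G (shift T u) 1 × ∣ shift T u ∣ ≤ ∣ T ∣ × ∣ shift T u ∩ B ∣ < ∣ T ∩ B ∣
    shift-improves B-independent (T-col , _) u∈T v∈T u~v u∈B =
      edgeless⇒chromatic₁ (shift-edgeless (colourable₁⇒edgeless T-col)) u∉shift ,
      ∣shift∣≤∣S∣ u∈T v∈T u~v ,
      p⊂q⇒∣p∣<∣q∣ (shift∩B⊂ B-independent u∈T u∈B)

    shiftStep : ∀ {B} → Independent G B → EdgelessMinus B →
                ∀ T → IsChromNumMinus G T 1 → EdgeIn T →
                ∃ λ T′ → IsChromNumMinus G T′ 1 × ∣ T′ ∣ ≤ ∣ T ∣ × ∣ T′ ∩ B ∣ < ∣ T ∩ B ∣
    shiftStep {B} B-independent B-edgeless T χT (u , v , u∈T , v∈T , u~v) with u ∈? B | v ∈? B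
    ... | yes u∈B | _       = shift T u , shift-improves B-independent χT u∈T v∈T u~v u∈B
    ... | no _    | yes v∈B = shift T v , shift-improves B-independent χT v∈T u∈T (adj-sym u~v) v∈B
    ... | no u∉B  | no v∉B  = contradiction (B-edgeless u v u∉B v∉B) (not-¬ u~v)

    independentReduction : ∀ {S} → ChiReducing G S →
                           ∃ λ S′ → Independent G S′ × ChiReducing G S′ × ∣ S′ ∣ ≤ ∣ S ∣
    independentReduction {S} reducing@(zero , χG , _) =
      S , (λ u → ⊥-elim (¬Fin0 (proj₁ (proj₁ χG) u ∉⊥))) , reducing , ℕ.≤-refl
    independentReduction {S} reducing@(suc zero , χG , _) =
      S , (λ u v _ _ → colourable₁⇒edgeless (proj₁ χG) u v ∉⊥ ∉⊥) , reducing , ℕ.≤-refl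
    independentReduction {S} (suc (suc zero) , χG , χS) with peel (proj₁ χG)
    ... | B , B-independent , c
      with shrinkToIndependent (λ T → ∣ T ∩ B ∣)
             (shiftStep B-independent (colourable₁⇒edgeless (subst (λ T → ColourableMinus G T 1) (∪-identityˡ B) c)))
             S χS
    ...   | S′ , S′-independent , χS′ , ∣S′∣≤∣S∣ = S′ , S′-independent , (2 , χG , χS′) , ∣S′∣≤∣S∣
    independentReduction {S} (suc (suc (suc m)) , χG , χS) with shrinkToIndependent ∣_∣ removeStep S χS
    ... | S′ , S′-independent , χS′ , ∣S′∣≤∣S∣ = S′ , S′-independent , (suc (suc (suc m)) , χG , χS′) , ∣S′∣≤∣S∣

mainTheorem3 : ∀ {n} (G : Graph n) → MaxDegreeAtMost G 2 →
    ∃ λ m → IsVsChi G m × IsIvsChi G m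
mainTheorem3 G Δ≤2 with vsChi-exists G
... | m , vs@((S , S-reducing , refl) , minimum) with independentReduction G Δ≤2 S-reducing
... | S′ , S′-independent , S′-reducing , ∣S′∣≤∣S∣ =
  m , vs , (S′ , S′-independent , S′-reducing , ℕ.≤-antisym ∣S′∣≤∣S∣ (minimum S′ S′-reducing)) , λ T _ → minimum T
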